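{- Let $\mathcal{A} = (\Sigma, E, PRE)$ be an event model with preconditions in $\mathcal{L}_{\exists, U}$, let $\alpha \in \Sigma$, and let $\varphi \in \mathcal{L}_{\exists, U}$. If $\varphi$ and all the preconditions $Pre_\beta$ ($\beta\in\Sigma$) have finite degree, then $\langle \alpha \rangle \varphi$ has finite degree.
   Context: A (relational) model is $\mathcal{M} = (\Omega, R, V)$ with $\Omega$ non-empty, $R \subseteq \Omega\times\Omega$, $V(p)\subseteq\Omega$ for each proposition letter $p$; a pointed model is a pair $(\mathcal{M},\omega)$ with $\omega\in\Omega$. The language $\mathcal{L}_{\exists, U}$ is $\varphi ::= p \mid \neg\varphi \mid \varphi \land \varphi \mid \square \varphi \mid \exists p.\varphi \mid U\varphi$, with usual Boolean clauses, $\square$ the box over $R$, $\mathcal{M},\omega \vDash \exists p.\varphi$ iff some $X\subseteq\Omega$ satisfies $\mathcal{M}[p\mapsto X],\omega\vDash\varphi$ (where $\mathcal{M}[p\mapsto X]$ revalues $p$ as $X$), and $U$ the global box. An event model is $\mathcal{A} = (\Sigma, E, PRE)$ with $\Sigma$ finite non-empty, $E \subseteq \Sigma\times\Sigma$, $PRE$ assigning a precondition formula $Pre_\beta$ to each $\beta\in\Sigma$. The product update $\mathcal{M}\otimes\mathcal{A}$ has domain $\{(\omega,\beta) \mid \mathcal{M},\omega\vDash Pre_\beta\}$, $(\omega,\beta)$ related to $(\omega',\beta')$ iff $\omega R\omega'$ and $\beta E \beta'$, and $p$ true at $(\omega,\beta)$ iff $\omega \in V(p)$; $\mathcal{M},\omega\vDash\langle\alpha\rangle\varphi$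 iff $\mathcal{M},\omega\vDash Pre_\alpha$ and $\mathcal{M}\otimes\mathcal{A},(\omega,\alpha)\vDash\varphi$. For $k\in\mathbb{N}$, $\mathcal{M}^k_\omega$ is the submodel of $\mathcal{M}$ (restricted relation and valuation) whose domain is the set of points reachable from $\omega$ by at most $k$ steps along $R$. A formula $\theta$ has degree $k$ if for all pointed models $(\mathcal{M},\omega)$: $\mathcal{M},\omega\vDash\theta$ iff $\mathcal{M}^k_\omega,\omega\vDash\theta$; $\theta$ has finite degree if it has degree $k$ for some $k\in\mathbb{N}$. -}

module Defs where

open import Level using (Lift)
open import Data.Nat using (ℕ; zero; suc; _≟_)
open import Data.Fin using (Fin)
open import Data.Bool using (if_then_else_)
open import Data.Product using (Σ; _×_)
open import Relation.Nullary using (¬_)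
open import Relation.Nullary.Decidable using (⌊_⌋)

data Form : Set where
  var  : ℕ → Form
  neg  : Form → Form
  and  : Form → Form → Form
  box  : Form → Form
  ex   : ℕ → Form → Form
  glob : Form → Form

-- The domain lives in Set₁ so that the domain of a
-- product update (a subset cut out by satisfaction, which is Set₁-valued)
-- is again a model of the same kind.
record Model : Set₂ where
  field
    Ω : Set₁
    R : Ω → Ω → Set
    V : ℕ → Ω → Set
open Model public

_[_↦_] : (M : Model) → ℕ → (Ω M → Set) → Model
M [ p ↦ X ] = record
  { Ω = Ω M
  ; R = R M
  ; V = λ q → if ⌊ q ≟ p ⌋ then X else V M q }

Sat : (M : Model) → Ω M → Form → Set₁
Sat M w (var p)   = Lift _ (V M p w)
Sat M w (neg φ)   = ¬ Sat M w φ
Sat M w (and φ ψ) = Sat M w φ × Sat M w ψ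
Sat M w (box φ)   = ∀ v → R M w v → Sat M v φ
Sat M w (ex p φ)  = Σ (Ω M → Set) λ X → Sat (M [ p ↦ X ]) w φ
Sat M w (glob φ)  = ∀ v → Sat M v φ

-- Reachability in at most k steps
data Reach (M : Model) : ℕ → Ω M → Ω M → Set₁ where
  here : ∀ {k w} → Reach M k w w
  step : ∀ {k w u v} → R M w u → Reach M k u v → Reach M (suc k) w v

-- Points of the generated submodel M^k_ω: the proof of reachability is
-- an irrelevant field, so this is genuinely a subset of Ω.
record SubPt (M : Model) (k : ℕ) (w : Ω M) : Set₁ where
  constructor subpt
  field
    pt     : Ω M
    .reach : Reach M k w pt
open SubPt public

Sub : (M : Model) → ℕ → Ω M → Model
Sub M k w = record
  { Ω = SubPt M k w
  ; R = λ a b → R M (pt a) (pt b)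
  ; V = λ p a → V M p (pt a) }

root : (M : Model) (k : ℕ) (w : Ω M) → SubPt M k w
root M k w = subpt w here

PointedProp : Set₂
PointedProp = (M : Model) → Ω M → Set₁

HasDegree : ℕ → PointedProp → Set₂
HasDegree k P = ∀ (M : Model) (w : Ω M) →
  (P M w → P (Sub M k w) (root M k w)) × (P (Sub M k w) (root M k w) → P M w)

HasFiniteDegree : PointedProp → Set₂
HasFiniteDegree P = Σ ℕ λ k → HasDegree k P

⟦_⟧ : Form → PointedProp
⟦ φ ⟧ M w = Sat M w φ

record EventModel : Set₁ where
  field
    size : ℕ
    E    : Fin size → Fin size → Set
    Pre  : Fin size → Form
open EventModel public

-- Points of the product update: pairs (ω,β) with M,ω ⊨ Pre_β
-- (the precondition proof is irrelevant, so this is a subset of Ω × Σ).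
record ProdPt (M : Model) (A : EventModel) : Set₁ where
  constructor prodpt
  field
    world : Ω M
    event : Fin (size A)
    .ok   : Sat M world (Pre A event)
open ProdPt public

_⊗_ : Model → EventModel → Model
M ⊗ A = record
  { Ω = ProdPt M A
  ; R = λ a b → R M (world a) (world b) × E A (event a) (event b)
  ; V = λ p a → V M p (world a) }

Dia : (A : EventModel) → Fin (size A) → Form → PointedProp
Dia A α φ M w = Σ (Sat M w (Pre A α)) λ h → Sat (M ⊗ A) (prodpt w α h) φ

-- If φ has degree k and every precondition has degree at most D, then ⟨α⟩φ has
-- degree k + D.  Every point of (M ⊗ A)^k_(ω,α) has the form (v,β) with v at
-- most k steps from ω, so whether Pre_β holds at v is decided inside
-- M^(k+D)_ω.  Hence (M ⊗ A)^k_(ω,α) and (M^(k+D)_ω ⊗ A)^k_(ω,α) are isomorphic,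
-- and truth of φ is invariant under isomorphism (also for ∃p, since an
-- isomorphism transports valuations).
module Submission where

open import Defs
open import Data.Fin using (Fin; zero; suc)
open import Data.Nat using (ℕ; zero; suc; _+_; _≤_; _⊔_; _≟_; s≤s)
open import Data.Nat.Properties using (≤-refl; m≤n+m; m≤m+n; m≤m⊔n; m≤n⊔m; m+n≤o⇒m≤o; +-suc)
open import Data.Product using (Σ; _,_; proj₁; proj₂)
open import Function using (_∘_; id)
open import Function.Bundles using (_⇔_; mk⇔; Equivalence)
import Function.Properties.Equivalence as ⇔
open import Level using (lift; lower)
open import Relation.Binary.PropositionalEquality using (_≡_; refl; sym; subst)
open import Relation.Nullary using (yes; no)

open Equivalence using () renaming (to to ⇒; from to ⇐)

infix 4 _≅_

record _≅_ (M N : Model) : Set₁ where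
  field
    to      : Ω M → Ω N
    from    : Ω N → Ω M
    from∘to : ∀ x → from (to x) ≡ x
    to∘from : ∀ y → to (from y) ≡ y
    to-R    : ∀ {x y} → R M x y → R N (to x) (to y)
    from-R  : ∀ {x y} → R N x y → R M (from x) (from y)
    to-V    : ∀ p x → V M p x → V N p (to x)
    from-V  : ∀ p y → V N p y → V M p (from y)
open _≅_

≅-sym : ∀ {M N} → M ≅ N → N ≅ M
≅-sym I = record
  { to = from I ; from = to I ; from∘to = to∘from I ; to∘from = from∘to I
  ; to-R = from-R I ; from-R = to-R I ; to-V = from-V I ; from-V = to-V I }

≅-revalue : ∀ {M N} (I : M ≅ N) p (X : Ω M → Set) → M [ p ↦ X ] ≅ N [ p ↦ (X ∘ from I) ]
≅-revalue {M} {N} I p X = record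
  { to = to I ; from = from I ; from∘to = from∘to I ; to∘from = to∘from I
  ; to-R = to-R I ; from-R = from-R I ; to-V = to-V′ ; from-V = from-V′ }
  where
  to-V′ : ∀ q x → V (M [ p ↦ X ]) q x → V (N [ p ↦ (X ∘ from I) ]) q (to I x)
  to-V′ q x with q ≟ p
  ... | yes _ = subst X (sym (from∘to I x))
  ... | no _  = to-V I q x
  from-V′ : ∀ q y → V (N [ p ↦ (X ∘ from I) ]) q y → V (M [ p ↦ X ]) q (from I y)
  from-V′ q y with q ≟ p
  ... | yes _ = id
  ... | no _  = from-V I q y

Sat-≅ : ∀ {M N} (I : M ≅ N) φ w → Sat M w φ → Sat N (to I w) φ
Sat-≅ I (var p) w s = lift (to-V I p w (lower s))
Sat-≅ {M} I (neg φ) w s t =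
  s (subst (λ x → Sat M x φ) (from∘to I w) (Sat-≅ (≅-sym I) φ (to I w) t))
Sat-≅ I (and φ ψ) w (s , t) = Sat-≅ I φ w s , Sat-≅ I ψ w t
Sat-≅ {M} {N} I (box φ) w s y e =
  subst (λ x → Sat N x φ) (to∘from I y)
    (Sat-≅ I φ (from I y) (s (from I y) (subst (λ x → R M x (from I y)) (from∘to I w) (from-R I e))))
Sat-≅ I (ex p φ) w (X , s) = X ∘ from I , Sat-≅ (≅-revalue I p X) φ w s
Sat-≅ {N = N} I (glob φ) w s y =
  subst (λ x → Sat N x φ) (to∘from I y) (Sat-≅ I φ (from I y) (s (from I y)))

Sat-≅-⇔ : ∀ {M N} (I : M ≅ N) φ w → Sat M w φ ⇔ Sat N (to I w) φ
Sat-≅-⇔ {M} I φ w = mk⇔ (Sat-≅ I φ w)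
  (subst (λ x → Sat M x φ) (from∘to I w) ∘ Sat-≅ (≅-sym I) φ (to I w))

Reach-weaken : ∀ {M j j′ w v} → j ≤ j′ → Reach M j w v → Reach M j′ w v
Reach-weaken _         here       = here
Reach-weaken (s≤s j≤j′) (step e r) = step e (Reach-weaken j≤j′ r)

Reach-++ : ∀ {M j d u v x} → Reach M j u v → Reach M d v x → Reach M (j + d) u x
Reach-++ {j = j} {d} here r = Reach-weaken (m≤n+m d j) r
Reach-++ (step e r) r′      = step e (Reach-++ r r′)

Reach-snoc : ∀ {M j u v x} → Reach M j u v → R M v x → Reach M (suc j) u x
Reach-snoc here       e = step e here
Reach-snoc (step e r) e′ = step e (Reach-snoc r e′)

Reach-map : ∀ {M N d u v} (f : Ω M → Ω N) → (∀ {x y} → R M x y → R N (f x) (f y)) →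
            Reach M d u v → Reach N d (f u) (f v)
Reach-map f f-R here       = here
Reach-map f f-R (step e r) = step (f-R e) (Reach-map f f-R r)

-- Lifting along a map defined only on the n-ball around w: a path of length d
-- from a point at distance j stays in the ball as long as j + d ≤ n.
module _ {M N : Model} {n : ℕ} {w : Ω M}
         (F : (u : Ω M) → .(Reach M n w u) → Ω N)
         (F-R : ∀ {u v} .(ru : Reach M n w u) .(rv : Reach M n w v) → R M u v → R N (F u ru) (F v rv))
  where

  Reach-lift : ∀ {j d u v} (ru : Reach M j w u) (r : Reach M d u v) (le : j + d ≤ n) →
               Reach N d (F u (Reach-weaken (m+n≤o⇒m≤o j le) ru)) (F v (Reach-weaken le (Reach-++ ru r)))
  Reach-lift ru here le = here
  Reach-lift {j} {suc d} ru (step e r) le =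
    step (F-R _ _ e) (Reach-lift (Reach-snoc ru e) r (subst (_≤ n) (+-suc j d) le))

Sub-Sub-≅ : ∀ {M K j d w u} (ru : Reach M j w u) (le : j + d ≤ K) →
            Sub M d u ≅ Sub (Sub M K w) d (subpt u (Reach-weaken (m+n≤o⇒m≤o j le) ru))
Sub-Sub-≅ {M} {K} {j} {d} {w} {u} ru le = record
  { to = λ { (subpt x r) → subpt (subpt x _) (Reach-lift subpt (λ _ _ → id) ru r le) }
  ; from = λ { (subpt (subpt x _) r) → subpt x (Reach-map pt id r) }
  ; from∘to = λ _ → refl ; to∘from = λ _ → refl
  ; to-R = id ; from-R = id ; to-V = λ _ _ → id ; from-V = λ _ _ → id }

HasDegree-⇔ : ∀ {d θ} → HasDegree d ⟦ θ ⟧ → ∀ M w → Sat M w θ ⇔ Sat (Sub M d w) (root M d w) θ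
HasDegree-⇔ deg M w = mk⇔ (proj₁ (deg M w)) (proj₂ (deg M w))

Sat-Sub-local : ∀ {d θ} → HasDegree d ⟦ θ ⟧ →
                ∀ {M K j w u} (ru : Reach M j w u) (le : j + d ≤ K) →
                Sat M u θ ⇔ Sat (Sub M K w) (subpt u (Reach-weaken (m+n≤o⇒m≤o j le) ru)) θ
Sat-Sub-local {d} {θ} deg {M} {K} ru le =
  ⇔.trans (HasDegree-⇔ deg M _)
    (⇔.trans (Sat-≅-⇔ (Sub-Sub-≅ ru le) θ _)
      (⇔.sym (HasDegree-⇔ deg (Sub M K _) _)))

HasDegree-mono : ∀ {d d′ θ} → HasDegree d ⟦ θ ⟧ → d ≤ d′ → HasDegree d′ ⟦ θ ⟧
HasDegree-mono deg d≤d′ M w = ⇒ local , ⇐ local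
  where local = Sat-Sub-local deg {M} here d≤d′

HasDegree-common : ∀ n (θ : Fin n → Form) → (∀ i → HasFiniteDegree ⟦ θ i ⟧) →
                   Σ ℕ λ D → ∀ i → HasDegree D ⟦ θ i ⟧
HasDegree-common zero    θ fin = 0 , λ ()
HasDegree-common (suc n) θ fin with fin zero | HasDegree-common n (θ ∘ suc) (fin ∘ suc)
... | d , deg | D , degs = d ⊔ D , λ
  { zero    → HasDegree-mono deg (m≤m⊔n d D)
  ; (suc i) → HasDegree-mono (degs i) (m≤n⊔m d D) }

module _ (A : EventModel) {D : ℕ} (pre-deg : ∀ β → HasDegree D ⟦ Pre A β ⟧)
         (M : Model) (w : Ω M) (k : ℕ) where

  private
    K : ℕ
    K = k + D

    Pre-local : ∀ β {u} (ru : Reach M k w u) →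
                Sat M u (Pre A β) ⇔ Sat (Sub M K w) (subpt u (Reach-weaken (m≤m+n k D) ru)) (Pre A β)
    Pre-local β ru = Sat-Sub-local (pre-deg β) ru ≤-refl

  ⊗-Sub-≅ : ∀ α h .(h′ : Sat (Sub M K w) (root M K w) (Pre A α)) →
            Sub (M ⊗ A) k (prodpt w α h) ≅ Sub (Sub M K w ⊗ A) k (prodpt (root M K w) α h′)
  ⊗-Sub-≅ α h h′ = record
    { to = λ { (subpt a r) → subpt (F a r) (Reach-lift F (λ _ _ → id) here r ≤-refl) }
    ; from = λ { (subpt c r) → subpt (G c r) (Reach-lift G (λ _ _ → id) here r ≤-refl) }
    ; from∘to = λ _ → refl ; to∘from = λ _ → refl
    ; to-R = id ; from-R = id ; to-V = λ _ _ → id ; from-V = λ _ _ → id }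
    where
    F : (a : ProdPt M A) → .(Reach (M ⊗ A) k (prodpt w α h) a) → ProdPt (Sub M K w) A
    F (prodpt v β hv) r = prodpt (subpt v _) β (⇒ (Pre-local β (Reach-map world proj₁ r)) hv)
    G : (c : ProdPt (Sub M K w) A) → .(Reach (Sub M K w ⊗ A) k (prodpt (root M K w) α h′) c) → ProdPt M A
    G (prodpt (subpt v _) β hv) r = prodpt v β (⇐ (Pre-local β (Reach-map (pt ∘ world) proj₁ r)) hv)

  Dia-local : ∀ α φ → HasDegree k ⟦ φ ⟧ → Dia A α φ M w ⇔ Dia A α φ (Sub M K w) (root M K w)
  Dia-local α φ deg = mk⇔
    (λ (h , s) → ⇒ (Pre-local α here) h , ⇒ (update h) s)
    (λ (h′ , s′) → let h = ⇐ (Pre-local α here) h′ in h , ⇐ (update h) s′)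
    where
    update : ∀ h .{h′} → Sat (M ⊗ A) (prodpt w α h) φ ⇔ Sat (Sub M K w ⊗ A) (prodpt (root M K w) α h′) φ
    update h {h′} =
      ⇔.trans (HasDegree-⇔ deg (M ⊗ A) _)
        (⇔.trans (Sat-≅-⇔ (⊗-Sub-≅ α h h′) φ _)
          (⇔.sym (HasDegree-⇔ deg (Sub M K w ⊗ A) _)))

lemma3 : (A : EventModel) (α : Fin (size A)) (φ : Form) →
    HasFiniteDegree ⟦ φ ⟧ →
    (∀ (β : Fin (size A)) → HasFiniteDegree ⟦ Pre A β ⟧) →
    HasFiniteDegree (Dia A α φ)
lemma3 A α φ (k , φ-deg) pre-fin with HasDegree-common (size A) (Pre A) pre-fin
... | D , pre-deg = k + D , λ M w →
  let local = Dia-local A pre-deg M w k α φ φ-deg in ⇒ local , ⇐ local
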